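{- Let $b>2$ be an integer. Then for all integers $\lambda\ge1$ and $N\ge1$ there exists $n\ge N$ such that \[ U_b((n+\lambda)!)\not\equiv U_b(n!)\pmod b. \]
   Context: For integers $b\ge2$ and $n\ge1$, $v_b(n)=\max\{e\ge0: b^e\mid n\}$ and $U_b(n)=n/b^{v_b(n)}$. -}

module Defs where

open import Data.Nat using (ℕ; zero; suc; _≤_; _<_; NonZero; _+_)
open import Data.Nat.DivMod using (_/_; _%_)
open import Data.Nat.Properties using (_≟_)
open import Relation.Nullary using (yes; no)

-- Remove factors of b from m, using at most `fuel` divisions.
-- For m ≥ 1 and b ≥ 2 at most m divisions are ever needed (b^e ≤ m),
-- so fuel = m suffices.
strip : (b : ℕ) → .{{NonZero b}} → (fuel m : ℕ) → ℕ
strip b zero    m = m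
strip b (suc k) zero = zero
strip b (suc k) m@(suc _) with m % b ≟ 0
... | yes _ = strip b k (m / b)
... | no  _ = m

-- U_b(n) = n / b^{v_b(n)}  (meaningful for b ≥ 2, n ≥ 1)
U : (b : ℕ) → .{{NonZero b}} → ℕ → ℕ
U b n = strip b n n

-- Write a(n) = U_b(n!) mod b and λ = L + 1.  Split L! = d·r and λ = d_λ·r_λ with d, d_λ dividing
-- powers of b and r, r_λ prime to b, and put h = b^s/d, T = b^E·h for a large E.  Since
-- (m+1)(m+2)⋯(m+λ) ≡ (m+1)·L! modulo (m+1)², whenever m + 1 = T·u this block equals
-- b^D·u·(r + bZ), so U_b((m+λ)!) is the b-free part of U_b(m!)·u·(r + bZ); for u prime to b,
-- a(m+λ) ≡ a(m)·u·r (mod b).  The points m with m + 1 = T·(1 + r_λ w) lie in a single class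
-- mod λ above m₀ = T - 1.  If a(n+λ) = a(n) held at all of them, then u = 1 and u ≡ -1 (mod b)
-- give 2a(m₀) ≡ 0, i.e. b = 2α with α = a(m₀).  For α even, u = 1 + r_λ² = 2·odd makes
-- a(m+λ) odd while a(m) = α.  For α odd, b = 2·odd and U_b(m₀!) is odd, so
-- v_2(m₀!) = v_b(m₀!) ≤ v_p(m₀!) for an odd prime p ∣ b, whereas v_2(n!) > n/2 ≥ v_p(n!)
-- for n ≥ 4.  Only finitely many points are involved, so a witness can be found by search.

module Submission where

open import Defs

open import Data.Empty using (⊥-elim)
open import Data.List.Base using ([]; _∷_)
open import Data.List.Relation.Unary.All using (_∷_)
open import Data.Nat.Base
open import Data.Nat.Coprimality as Coprimality
  using (Coprime; coprime?; coprime-divisor; coprime-Bézout; gcd≡1⇒coprime)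
open import Data.Nat.Divisibility
open import Data.Nat.DivMod
open import Data.Nat.GCD using (module Bézout; gcd; gcd[m,n]∣m; gcd[m,n]∣n; gcd[m,n]≡0⇒m≡0)
open import Data.Nat.Induction using (<-wellFounded)
open import Data.Nat.ListAction using (product)
open import Data.Nat.Primality using (Prime; euclidsLemma; prime[2]; prime⇒nonTrivial; prime⇒nonZero)
open import Data.Nat.Primality.Factorisation using (factorise)
open import Data.Nat.Properties
open import Algebra.Properties.CommutativeSemigroup *-commutativeSemigroup
  using (xy∙z≈xz∙y; xy∙z≈zx∙y; x∙yz≈y∙xz; x∙yz≈xz∙y)
open import Data.Nat.Tactic.RingSolver using (solve-∀)
open import Data.Product using (∃-syntax; ∃₂; _×_; _,_; proj₁; proj₂)
open import Data.Sum using (_⊎_; inj₁; inj₂; [_,_]′)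
open import Function using (_∘_)
open import Induction.WellFounded using (Acc; acc)
open import Relation.Binary.Definitions using (DecidableEquality)
open import Relation.Binary.PropositionalEquality
open import Relation.Nullary using (¬_; yes; no; ¬?; contradiction)
open import Relation.Nullary.Decidable using (decidable-stable)

private variable
  b c k m n p t u v x y : ℕ

prime⇒1< : Prime p → 1 < p
prime⇒1< {p} pr = nonTrivial⇒n>1 p {{prime⇒nonTrivial pr}}

∤1 : 1 < t → ¬ t ∣ 1
∤1 1<t t∣1 = <⇒≢ 1<t (sym (∣1⇒≡1 t∣1))

∤-* : Prime p → ¬ p ∣ m → ¬ p ∣ n → ¬ p ∣ m * n
∤-* {m = m} {n} pr p∤m p∤n p∣mn with euclidsLemma m n pr p∣mn
... | inj₁ p∣m = p∤m p∣m
... | inj₂ p∣n = p∤n p∣n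

∤-^ : Prime p → ¬ p ∣ m → ∀ v → ¬ p ∣ m ^ v
∤-^ pr p∤m zero    = ∤1 (prime⇒1< pr)
∤-^ pr p∤m (suc v) = ∤-* pr p∤m (∤-^ pr p∤m v)

∤-+-∣ : ¬ t ∣ m → t ∣ n → ¬ t ∣ m + n
∤-+-∣ {t} {m} {n} t∤m t∣n t∣m+n = t∤m (∣m+n∣m⇒∣n (subst (t ∣_) (+-comm m n) t∣m+n) t∣n)

∤⇒>0 : ¬ t ∣ n → 0 < n
∤⇒>0 {t} t∤n = n≢0⇒n>0 (λ n≡0 → t∤n (subst (t ∣_) (sym n≡0) (t ∣0)))

double⇒even : m + m ≡ n → 2 ∣ n
double⇒even {m} m+m≡n = divides m (trans (sym m+m≡n) (trans (cong (m +_) (sym (+-identityʳ m))) (*-comm 2 m)))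

odd⇒≡1+2* : ¬ 2 ∣ n → ∃[ y ] n ≡ 1 + 2 * y
odd⇒≡1+2* {zero}          2∤0 = contradiction (2 ∣0) 2∤0
odd⇒≡1+2* {suc zero}      _   = 0 , refl
odd⇒≡1+2* {suc (suc n)} 2∤2+n with odd⇒≡1+2* {n} (2∤2+n ∘ ∣m∣n⇒∣m+n ∣-refl)
... | y , refl = suc y , cong (2 +_) (sym (+-suc y (y + 0)))

∤1+2* : ¬ 2 ∣ 1 + 2 * y
∤1+2* {y} = ∤-+-∣ (∤1 ≤-refl) (m∣m*n y)

1+odd²≡2*odd : ¬ 2 ∣ x → ∃[ o ] (1 + x * x ≡ 2 * o × ¬ 2 ∣ o)
1+odd²≡2*odd 2∤x with odd⇒≡1+2* 2∤x
... | y , refl = 1 + 2 * (y + y * y) , square y , ∤1+2* {y + y * y}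
  where
  square : ∀ y → 1 + (1 + 2 * y) * (1 + 2 * y) ≡ 2 * (1 + 2 * (y + y * y))
  square = solve-∀

^-distribʳ-* : ∀ m n v → (m * n) ^ v ≡ m ^ v * n ^ v
^-distribʳ-* m n zero    = refl
^-distribʳ-* m n (suc v) = trans (cong (m * n *_) (^-distribʳ-* m n v)) (shuffle m n (m ^ v) (n ^ v))
  where
  shuffle : ∀ m n x y → m * n * (x * y) ≡ m * x * (n * y)
  shuffle = solve-∀

^-monoˡ-∣ : ∀ v → m ∣ n → m ^ v ∣ n ^ v
^-monoˡ-∣ zero    m∣n = ∣-refl
^-monoˡ-∣ (suc v) m∣n = *-pres-∣ m∣n (^-monoˡ-∣ v m∣n)

^-monoʳ-∣ : ∀ b → m ≤ n → b ^ m ∣ b ^ n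
^-monoʳ-∣ {m} {n} b m≤n =
  subst (b ^ m ∣_) (trans (sym (^-distribˡ-+-* b m (n ∸ m))) (cong (b ^_) (m+[n∸m]≡n m≤n))) (m∣m*n (b ^ (n ∸ m)))

^-∣-^⇒≤ : 1 < m → m ^ k ∣ m ^ v → k ≤ v
^-∣-^⇒≤ {m@(suc _)} {k} {v} 1<m m^k∣m^v with k ≤? v
... | yes k≤v = k≤v
... | no  k≰v = contradiction (∣⇒≤ {{m^n≢0 m v}} m^k∣m^v) (<⇒≱ (^-monoʳ-< m 1<m (≰⇒> k≰v)))

n<m^n : 1 < m → ∀ n → n < m ^ n
n<m^n           1<m zero    = z<s
n<m^n {m@(suc _)} 1<m (suc n) =
  ≤-<-trans (n<m^n 1<m n) (subst (m ^ n <_) (*-comm (m ^ n) m) (m<m*n (m ^ n) m {{m^n≢0 m n}} 1<m))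

prime^∣*⇒∣ : Prime p → ¬ p ∣ n → ∀ k → p ^ k ∣ m * n → p ^ k ∣ m
prime^∣*⇒∣ {m = m} pr p∤n zero    _ = 1∣ m
prime^∣*⇒∣ {p} {n} {m} pr p∤n (suc k) p^k+1∣mn with euclidsLemma m n pr (∣-trans (m∣m*n (p ^ k)) p^k+1∣mn)
... | inj₂ p∣n = contradiction p∣n p∤n
... | inj₁ (divides m′ refl) = subst (_∣ m′ * p) (*-comm (p ^ k) p) (*-monoˡ-∣ p p^k∣m′)
  where
  instance
    p≢0 : NonZero p
    p≢0 = prime⇒nonZero pr
  p^k∣m′ : p ^ k ∣ m′
  p^k∣m′ = prime^∣*⇒∣ pr p∤n k (*-cancelˡ-∣ p (subst (p * p ^ k ∣_) (shuffle m′ p n) p^k+1∣mn))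
    where
    shuffle : ∀ m p n → m * p * n ≡ p * (m * n)
    shuffle = solve-∀

^∣^*⇒∣ : ∀ {p} .{{_ : NonZero p}} k q → p ^ k ∣ p ^ q * x → p ^ (k ∸ q) ∣ x
^∣^*⇒∣ {x}     k       zero    p^k∣x  = subst (_ ∣_) (*-identityˡ x) p^k∣x
^∣^*⇒∣ {x}     zero    (suc q) _      = 1∣ x
^∣^*⇒∣ {x} {p} (suc k) (suc q) p^k+1∣ =
  ^∣^*⇒∣ k q (*-cancelˡ-∣ p (subst (p * p ^ k ∣_) (*-assoc p (p ^ q) x) p^k+1∣))

module _ {n} .{{_ : NonZero n}} where

  %-cong-*ʳ : ∀ x y z → x % n ≡ y % n → (x * z) % n ≡ (y * z) % n
  %-cong-*ʳ x y z x≡y = begin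
    (x * z) % n                 ≡⟨ %-distribˡ-* x z n ⟩
    ((x % n) * (z % n)) % n     ≡⟨ cong (λ t → (t * (z % n)) % n) x≡y ⟩
    ((y % n) * (z % n)) % n     ≡⟨ %-distribˡ-* y z n ⟨
    (y * z) % n                 ∎
    where open ≡-Reasoning

  %-cong-+ : ∀ x y z w → x % n ≡ y % n → z % n ≡ w % n → (x + z) % n ≡ (y + w) % n
  %-cong-+ x y z w x≡y z≡w = begin
    (x + z) % n                 ≡⟨ %-distribˡ-+ x z n ⟩
    ((x % n) + (z % n)) % n     ≡⟨ cong₂ (λ s t → (s + t) % n) x≡y z≡w ⟩
    ((y % n) + (w % n)) % n     ≡⟨ %-distribˡ-+ y w n ⟨
    (y + w) % n                 ∎
    where open ≡-Reasoning

  double≡0-mod⇒≡ : 0 < x → x < n → (x + x) % n ≡ 0 → x + x ≡ n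
  double≡0-mod⇒≡ {x} 0<x x<n 2x%n≡0 with m%n≡0⇒n∣m (x + x) n 2x%n≡0
  ... | divides zero       2x≡0   = contradiction (m+n≡0⇒m≡0 x 2x≡0) (>⇒≢ 0<x)
  ... | divides (suc zero) 2x≡n   = trans 2x≡n (+-identityʳ n)
  ... | divides (2+ q)     2x≡2n+ =
    contradiction (+-mono-< x<n x<n) (≤⇒≯ (subst (n + n ≤_) (sym 2x≡2n+) (+-monoʳ-≤ n (m≤m+n n (q * n)))))

coprime-* : Coprime b m → Coprime b n → Coprime b (m * n)
coprime-* b⊥m b⊥n (d∣b , d∣mn) = b⊥n (d∣b , coprime-divisor (λ (e∣d , e∣m) → b⊥m (∣-trans e∣d d∣b , e∣m)) d∣mn)

coprime-+-* : ∀ z → Coprime b m → Coprime b (m + b * z)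
coprime-+-* {b} {m} z b⊥m {d} (d∣b , d∣m+bz) =
  b⊥m (d∣b , ∣m+n∣m⇒∣n (subst (d ∣_) (+-comm m (b * z)) d∣m+bz) (∣m⇒∣m*n z d∣b))

suc≡*⇒coprime : suc m ≡ b * t → Coprime b m
suc≡*⇒coprime {m} {b} {t} m+1≡bt {d} (d∣b , d∣m) =
  ∣1⇒≡1 (∣m+n∣m⇒∣n (subst (d ∣_) (trans (sym m+1≡bt) (+-comm 1 m)) (∣m⇒∣m*n t d∣b)) d∣m)

coprime-even⇒odd : Coprime m b → 2 ∣ b → ¬ 2 ∣ m
coprime-even⇒odd m⊥b 2∣b 2∣m = contradiction (m⊥b (2∣m , 2∣b)) λ ()

-- Abstract, like coprime-split and m₀ below: these witnesses must never be unfolded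
-- when U is applied to factorials built from them.
abstract
  coprime⇒solvable : ∀ {r b} .{{_ : NonZero b}} → Coprime r b → ∀ c → ∃₂ λ w t → r * w + c ≡ b * t
  coprime⇒solvable {r} {b@(suc b′)} r⊥b c with coprime-Bézout r⊥b
  ... | Bézout.-+ x y 1+xr≡yb = c * x , c * y , (begin
    r * (c * x) + c      ≡⟨ lhs r c x ⟩
    c * (1 + x * r)      ≡⟨ cong (c *_) 1+xr≡yb ⟩
    c * (y * b)          ≡⟨ rhs c y b ⟩
    b * (c * y)          ∎)
    where
    open ≡-Reasoning
    lhs : ∀ r c x → r * (c * x) + c ≡ c * (1 + x * r)
    lhs = solve-∀
    rhs : ∀ c y b → c * (y * b) ≡ b * (c * y)
    rhs = solve-∀
  ... | Bézout.+- x y 1+yb≡xr = x * c * b′ , c + y * c * b′ , (begin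
    r * (x * c * b′) + c             ≡⟨ lhs r x c b′ ⟩
    x * r * c * b′ + c               ≡⟨ cong (λ t → t * c * b′ + c) 1+yb≡xr ⟨
    (1 + y * suc b′) * c * b′ + c    ≡⟨ rhs y c b′ ⟩
    suc b′ * (c + y * c * b′)        ∎)
    where
    open ≡-Reasoning
    lhs : ∀ r x c b′ → r * (x * c * b′) + c ≡ x * r * c * b′ + c
    lhs = solve-∀
    rhs : ∀ y c b′ → (1 + y * suc b′) * c * b′ + c ≡ suc b′ * (c + y * c * b′)
    rhs = solve-∀

record CoprimeSplit (b y : ℕ) : Set where
  field
    d r s  : ℕ
    y≡d*r  : y ≡ d * r
    d∣b^s  : d ∣ b ^ s
    r⊥b    : Coprime r b

abstract
  coprime-split : ∀ b y → 1 ≤ y → CoprimeSplit b y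
  coprime-split b y = go y (<-wellFounded y)
    where
    go : ∀ y → Acc _<_ y → 1 ≤ y → CoprimeSplit b y
    go y (acc rec) 1≤y with coprime? y b
    ... | yes y⊥b = record { d = 1 ; r = y ; s = 0 ; y≡d*r = sym (*-identityˡ y) ; d∣b^s = ∣-refl ; r⊥b = y⊥b }
    ... | no  y⊥̸b = record
      { d = g * S.d ; r = S.r ; s = suc S.s
      ; y≡d*r = trans y≡y′*g (trans (cong (_* g) S.y≡d*r) (xy∙z≈zx∙y S.d S.r g))
      ; d∣b^s = *-pres-∣ (gcd[m,n]∣n y b) S.d∣b^s
      ; r⊥b   = S.r⊥b
      }
      where
      g : ℕ
      g = gcd y b
      g∣y : g ∣ y
      g∣y = gcd[m,n]∣m y b
      y′ : ℕ
      y′ = quotient g∣y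
      y≡y′*g : y ≡ y′ * g
      y≡y′*g = m∣n⇒n≡quotient*m g∣y
      1<g : 1 < g
      1<g = ≤∧≢⇒< (n≢0⇒n>0 (>⇒≢ 1≤y ∘ gcd[m,n]≡0⇒m≡0)) (y⊥̸b ∘ gcd≡1⇒coprime ∘ sym)
      y′<y : y′ < y
      y′<y = quotient-< g∣y {{n>1⇒nonTrivial 1<g}} {{>-nonZero 1≤y}}
      1≤y′ : 1 ≤ y′
      1≤y′ = n≢0⇒n>0 (λ y′≡0 → >⇒≢ 1≤y (trans y≡y′*g (cong (_* g) y′≡0)))
      module S = CoprimeSplit {b} {y′} (go y′ (rec y′<y) 1≤y′)

-- Prime powers in factorials

factorial-prime-split : Prime p → ∀ q r → r < p → ∃[ k ] (¬ p ∣ k × (p * q + r) ! ≡ p ^ q * q ! * k)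
factorial-prime-split {p} pr zero zero _ =
  1 , ∤1 (prime⇒1< pr) , cong _! (trans (+-identityʳ (p * 0)) (*-zeroʳ p))
factorial-prime-split {p@(suc p′)} pr (suc q) zero _ with factorial-prime-split pr q p′ ≤-refl
... | k , p∤k , eq = k , p∤k , (begin
  (p * suc q + 0) !                  ≡⟨ cong _! (last-block p′ q) ⟩
  suc (p * q + p′) * (p * q + p′) !  ≡⟨ cong (suc (p * q + p′) *_) eq ⟩
  suc (p * q + p′) * (p ^ q * q ! * k) ≡⟨ regroup p′ q (p ^ q) (q !) k ⟩
  p ^ suc q * suc q ! * k            ∎)
  where
  open ≡-Reasoning
  last-block : ∀ p′ q → suc p′ * suc q + 0 ≡ suc (suc p′ * q + p′)
  last-block = solve-∀
  regroup : ∀ p′ q P F k → suc (suc p′ * q + p′) * (P * F * k) ≡ suc p′ * P * (suc q * F) * k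
  regroup = solve-∀
factorial-prime-split {p} pr q (suc r) r+1<p with factorial-prime-split pr q r (<-trans (n<1+n r) r+1<p)
... | k , p∤k , eq = suc (p * q + r) * k , ∤-* pr p∤pq+r+1 p∤k , (begin
  (p * q + suc r) !                     ≡⟨ cong _! (+-suc (p * q) r) ⟩
  suc (p * q + r) * (p * q + r) !       ≡⟨ cong (suc (p * q + r) *_) eq ⟩
  suc (p * q + r) * (p ^ q * q ! * k)   ≡⟨ regroup (suc (p * q + r)) (p ^ q) (q !) k ⟩
  p ^ q * q ! * (suc (p * q + r) * k)   ∎)
  where
  open ≡-Reasoning
  regroup : ∀ a P F k → a * (P * F * k) ≡ P * F * (a * k)
  regroup = solve-∀
  p∤pq+r+1 : ¬ p ∣ suc (p * q + r)
  p∤pq+r+1 p∣ = <⇒≱ r+1<p (∣⇒≤ (∣m+n∣m⇒∣n (subst (p ∣_) (sym (+-suc (p * q) r)) p∣) (m∣m*n q)))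

module _ {p} (pr : Prime p) where

  private instance
    p≢0 : NonZero p
    p≢0 = prime⇒nonZero pr

  prime^∣!⇒≤ : ∀ n k → p ^ k ∣ n ! → (p ∸ 1) * k ≤ n
  prime^∣!⇒≤ n = go n (<-wellFounded n)
    where
    go : ∀ n → Acc _<_ n → ∀ k → p ^ k ∣ n ! → (p ∸ 1) * k ≤ n
    go zero    _         k p^k∣1 =
      ≤-reflexive (trans (cong ((p ∸ 1) *_) (n≤0⇒n≡0 (^-∣-^⇒≤ (prime⇒1< pr) p^k∣1))) (*-zeroʳ (p ∸ 1)))
    go n@(suc _) (acc rec) k p^k∣n! = begin
      (p ∸ 1) * k                       ≤⟨ *-monoʳ-≤ (p ∸ 1) (m≤n+m∸n k q) ⟩
      (p ∸ 1) * (q + (k ∸ q))           ≡⟨ *-distribˡ-+ (p ∸ 1) q (k ∸ q) ⟩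
      (p ∸ 1) * q + (p ∸ 1) * (k ∸ q)   ≤⟨ +-monoʳ-≤ ((p ∸ 1) * q) (go q (rec q<n) (k ∸ q) p^[k∸q]∣q!) ⟩
      (p ∸ 1) * q + q                   ≡⟨ cong ((p ∸ 1) * q +_) (*-identityˡ q) ⟨
      (p ∸ 1) * q + 1 * q               ≡⟨ *-distribʳ-+ q (p ∸ 1) 1 ⟨
      (p ∸ 1 + 1) * q                   ≡⟨ cong (_* q) (m∸n+n≡m (<⇒≤ (prime⇒1< pr))) ⟩
      p * q                             ≤⟨ m≤m+n (p * q) r ⟩
      p * q + r                         ≡⟨ n≡pq+r ⟨
      n                                 ∎
      where
      open ≤-Reasoning
      q r : ℕ
      q = n / p
      r = n % p
      q<n : q < n
      q<n = m/n<m n p (prime⇒1< pr)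
      n≡pq+r : n ≡ p * q + r
      n≡pq+r = trans (m≡m%n+[m/n]*n n p) (trans (+-comm r (q * p)) (cong (_+ r) (*-comm q p)))
      p^[k∸q]∣q! : p ^ (k ∸ q) ∣ q !
      p^[k∸q]∣q! with factorial-prime-split pr q r (m%n<n n p)
      ... | k′ , p∤k′ , eq =
        ^∣^*⇒∣ k q (prime^∣*⇒∣ pr p∤k′ k (subst (p ^ k ∣_) (trans (cong _! n≡pq+r) eq) p^k∣n!))

-- k = ⌊n/2⌋ + 1: the even numbers up to n give 2^⌊n/2⌋·⌊n/2⌋!, and 2 ∣ ⌊n/2⌋! once n ≥ 4.
2^∣!-large : 4 ≤ n → ∃[ k ] (2 ^ k ∣ n ! × n < 2 * k)
2^∣!-large {n} 4≤n with factorial-prime-split prime[2] (n / 2) (n % 2) (m%n<n n 2)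
... | k′ , _ , n!≡ = suc q , 2^q+1∣n! , n<2q+2
  where
  q r : ℕ
  q = n / 2
  r = n % 2
  n≡2q+r : n ≡ 2 * q + r
  n≡2q+r = trans (m≡m%n+[m/n]*n n 2) (trans (+-comm r (q * 2)) (cong (_+ r) (*-comm q 2)))
  2∣q! : 2 ∣ q !
  2∣q! = m≤n⇒m!∣n! (/-monoˡ-≤ 2 4≤n)
  2^q+1∣n! : 2 ^ suc q ∣ n !
  2^q+1∣n! = subst₂ _∣_ (*-comm (2 ^ q) 2) (sym (trans (cong _! n≡2q+r) n!≡))
               (∣m⇒∣m*n k′ (*-monoʳ-∣ (2 ^ q) 2∣q!))
  n<2q+2 : n < 2 * suc q
  n<2q+2 = begin-strict
    n             ≡⟨ n≡2q+r ⟩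
    2 * q + r     <⟨ +-monoʳ-< (2 * q) (m%n<n n 2) ⟩
    2 * q + 2     ≡⟨ +-comm (2 * q) 2 ⟩
    2 + 2 * q     ≡⟨ *-suc 2 q ⟨
    2 * suc q     ∎
    where open ≤-Reasoning

prime-factor : 1 < n → ∃[ p ] (Prime p × p ∣ n)
prime-factor {n@(suc _)} 1<n with factorise n
... | record { factors = []    ; isFactorisation = n≡1 } = contradiction n≡1 (>⇒≢ 1<n)
... | record { factors = p ∷ ps ; isFactorisation = n≡p*ps ; factorsPrime = pr ∷ _ } =
  p , pr , subst (p ∣_) (sym n≡p*ps) (m∣m*n (product ps))

-- The b-free part U

b-free-part-unique : ∀ {b} .{{_ : NonZero b}} {u u′} e e′ → ¬ b ∣ u → ¬ b ∣ u′ →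
                     u * b ^ e ≡ u′ * b ^ e′ → u ≡ u′
b-free-part-unique {b} {u} {u′} zero zero _ _ eq = trans (sym (*-identityʳ u)) (trans eq (*-identityʳ u′))
b-free-part-unique {b} {u} {u′} zero (suc e′) b∤u _ eq =
  contradiction (divides (u′ * b ^ e′) (trans (sym (*-identityʳ u)) (trans eq (x∙yz≈xz∙y u′ b (b ^ e′))))) b∤u
b-free-part-unique (suc e) zero b∤u b∤u′ eq = sym (b-free-part-unique zero (suc e) b∤u′ b∤u (sym eq))
b-free-part-unique {b} {u} {u′} (suc e) (suc e′) b∤u b∤u′ eq =
  b-free-part-unique e e′ b∤u b∤u′
    (*-cancelˡ-≡ _ _ b (trans (x∙yz≈y∙xz b u (b ^ e)) (trans eq (x∙yz≈y∙xz u′ b (b ^ e′)))))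

module _ (b : ℕ) .{{_ : NonZero b}} (1<b : 1 < b) where

  strip-spec : ∀ fuel m → 1 ≤ m → m ≤ fuel → ∃[ e ] (m ≡ strip b fuel m * b ^ e × ¬ b ∣ strip b fuel m)
  strip-spec (suc fuel) m@(suc _) _ m≤fuel+1 with m % b ≟ 0
  ... | no  m%b≢0 = 0 , sym (*-identityʳ m) , m%b≢0 ∘ n∣m⇒m%n≡0 m b
  ... | yes m%b≡0 = divide-out (m%n≡0⇒n∣m m b m%b≡0)
    where
    divide-out : b ∣ m → ∃[ e ] (m ≡ strip b fuel (m / b) * b ^ e × ¬ b ∣ strip b fuel (m / b))
    divide-out b∣m with strip-spec fuel (m / b) (m≥n⇒m/n>0 (∣⇒≤ b∣m)) (≤-pred (≤-trans (m/n<m m b 1<b) m≤fuel+1))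
    ... | e , m/b≡s*b^e , b∤s = suc e , (begin
      m                ≡⟨ m/n*n≡m b∣m ⟨
      m / b * b        ≡⟨ cong (_* b) m/b≡s*b^e ⟩
      s * b ^ e * b    ≡⟨ xy∙z≈xz∙y s (b ^ e) b ⟩
      s * b * b ^ e    ≡⟨ *-assoc s b (b ^ e) ⟩
      s * b ^ suc e    ∎) , b∤s
      where
      open ≡-Reasoning
      s : ℕ
      s = strip b fuel (m / b)

  U-spec : 1 ≤ n → ∃[ e ] (n ≡ U b n * b ^ e × ¬ b ∣ U b n)
  U-spec {n} 1≤n = strip-spec n n 1≤n ≤-refl

  U-∤ : 1 ≤ n → ¬ b ∣ U b n
  U-∤ 1≤n = proj₂ (proj₂ (U-spec 1≤n))

  U-unique : ∀ e → ¬ b ∣ u → n ≡ u * b ^ e → U b n ≡ u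
  U-unique {u} {n} e b∤u n≡u*b^e with U-spec (subst (1 ≤_) (sym n≡u*b^e) (*-mono-≤ (∤⇒>0 b∤u) (m^n>0 b e)))
  ... | e₀ , n≡U*b^e₀ , b∤U = b-free-part-unique e₀ e b∤U b∤u (trans (sym n≡U*b^e₀) n≡u*b^e)

  U-*-unique : ∀ e → 1 ≤ x → ¬ b ∣ u → U b x * y ≡ u * b ^ e → U b (x * y) ≡ u
  U-*-unique {x} {u} {y} e 1≤x b∤u Uxy≡u*b^e with U-spec 1≤x
  ... | e₀ , x≡Ux*b^e₀ , _ = U-unique (e + e₀) b∤u (begin
    x * y                 ≡⟨ cong (_* y) x≡Ux*b^e₀ ⟩
    U b x * b ^ e₀ * y    ≡⟨ xy∙z≈xz∙y (U b x) (b ^ e₀) y ⟩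
    U b x * y * b ^ e₀    ≡⟨ cong (_* b ^ e₀) Uxy≡u*b^e ⟩
    u * b ^ e * b ^ e₀    ≡⟨ *-assoc u (b ^ e) (b ^ e₀) ⟩
    u * (b ^ e * b ^ e₀)  ≡⟨ cong (u *_) (^-distribˡ-+-* b e e₀) ⟨
    u * b ^ (e + e₀)      ∎)
    where open ≡-Reasoning

  U-factorial-even : b ≡ 2 * c → ¬ 2 ∣ c → 1 < c → 4 ≤ n → 2 ∣ U b (n !)
  U-factorial-even {c} {n} b≡2c 2∤c 1<c 4≤n with 2 ∣? U b (n !)
  ... | yes 2∣A = 2∣A
  ... | no  2∤A with U-spec (1≤n! n) | 2^∣!-large 4≤n | prime-factor 1<c
  ...   | v , n!≡A*b^v , _ | k , 2^k∣n! , n<2k | p , prime-p , p∣c = ⊥-elim (<-irrefl refl (begin-strict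
    n            <⟨ n<2k ⟩
    2 * k        ≤⟨ *-monoʳ-≤ 2 k≤v ⟩
    2 * v        ≤⟨ *-monoˡ-≤ v 2≤p∸1 ⟩
    (p ∸ 1) * v  ≤⟨ prime^∣!⇒≤ prime-p n v p^v∣n! ⟩
    n            ∎))
    where
    open ≤-Reasoning
    A : ℕ
    A = U b (n !)
    n!≡2^v*odd : n ! ≡ 2 ^ v * (A * c ^ v)
    n!≡2^v*odd = begin-equality
      n !                  ≡⟨ n!≡A*b^v ⟩
      A * b ^ v            ≡⟨ cong (λ t → A * t ^ v) b≡2c ⟩
      A * (2 * c) ^ v      ≡⟨ cong (A *_) (^-distribʳ-* 2 c v) ⟩
      A * (2 ^ v * c ^ v)  ≡⟨ x∙yz≈y∙xz A (2 ^ v) (c ^ v) ⟩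
      2 ^ v * (A * c ^ v)  ∎
    k≤v : k ≤ v
    k≤v = ^-∣-^⇒≤ ≤-refl (prime^∣*⇒∣ prime[2] (∤-* prime[2] 2∤A (∤-^ prime[2] 2∤c v)) k
            (subst (2 ^ k ∣_) n!≡2^v*odd 2^k∣n!))
    2≤p∸1 : 2 ≤ p ∸ 1
    2≤p∸1 = ∸-monoˡ-≤ 1 (≤∧≢⇒< (prime⇒1< prime-p) (λ 2≡p → 2∤c (subst (_∣ c) (sym 2≡p) p∣c)))
    p^v∣n! : p ^ v ∣ n !
    p^v∣n! = ∣-trans (^-monoˡ-∣ v (∣-trans p∣c (subst (c ∣_) (sym b≡2c) (n∣m*n 2))))
                     (subst (b ^ v ∣_) (sym n!≡A*b^v) (n∣m*n A))

-- Blocks of consecutive factors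

factorial-shift : ∀ m L → ∃[ Y ] (m + suc L) ! ≡ m ! * (suc m * (L ! + suc m * Y))
factorial-shift m zero = 0 , trans (cong _! (+-comm m 1)) (base m (m !))
  where
  base : ∀ m F → suc m * F ≡ F * (suc m * (1 + suc m * 0))
  base = solve-∀
factorial-shift m (suc L) with factorial-shift m L
... | Y , eq = L ! + suc L * Y + suc m * Y , (begin
  (m + suc (suc L)) !                            ≡⟨ cong _! (+-suc m (suc L)) ⟩
  suc (m + suc L) * (m + suc L) !                ≡⟨ cong (suc (m + suc L) *_) eq ⟩
  suc (m + suc L) * (m ! * (suc m * (L ! + suc m * Y))) ≡⟨ step m L (m !) (L !) Y ⟩
  m ! * (suc m * (suc L * L ! + suc m * (L ! + suc L * Y + suc m * Y))) ∎)
  where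
  open ≡-Reasoning
  step : ∀ m L M F Y → suc (m + suc L) * (M * (suc m * (F + suc m * Y))) ≡
                       M * (suc m * (suc L * F + suc m * (F + suc L * Y + suc m * Y)))
  step = solve-∀

factorial-block : ∀ {b h L s r} e u m → h * L ! ≡ b ^ s * r → suc m ≡ b ^ suc (s + e) * h * u →
                  ∃[ Z ] (m + suc L) ! ≡ m ! * b ^ (s + suc (s + e)) * (u * (r + b * Z))
factorial-block {b} {h} {L} {s} {r} e u m hL!≡B*r m+1≡ with factorial-shift m L
... | Y , shift = Z , (begin
  (m + suc L) !                                  ≡⟨ shift ⟩
  m ! * (suc m * (L ! + suc m * Y))              ≡⟨ cong (λ t → m ! * (t * (L ! + t * Y))) m+1≡X ⟩
  m ! * (X * (L ! + X * Y))                      ≡⟨ cong (m ! *_) (expand b B C h u (L !) Y) ⟩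
  m ! * (b * B * C * u * (h * L !) + X * X * Y)  ≡⟨ cong (λ t → m ! * (b * B * C * u * t + X * X * Y)) hL!≡B*r ⟩
  m ! * (b * B * C * u * (B * r) + X * X * Y)    ≡⟨ cong (m ! *_) (collect b B C h u r Y) ⟩
  m ! * (B * (b * (B * C)) * Q)                  ≡⟨ *-assoc (m !) _ Q ⟨
  m ! * (B * (b * (B * C))) * Q                  ≡⟨ cong (λ t → m ! * t * Q) b^s+s+e+1≡ ⟨
  m ! * b ^ (s + suc (s + e)) * Q                ∎)
  where
  open ≡-Reasoning
  B C X Z Q : ℕ
  B = b ^ s
  C = b ^ e
  X = b * (B * C) * h * u
  Z = C * h * h * u * Y
  Q = u * (r + b * Z)
  m+1≡X : suc m ≡ X
  m+1≡X = trans m+1≡ (cong (λ t → b * t * h * u) (^-distribˡ-+-* b s e))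
  b^s+s+e+1≡ : b ^ (s + suc (s + e)) ≡ B * (b * (B * C))
  b^s+s+e+1≡ = trans (^-distribˡ-+-* b s (suc (s + e))) (cong (λ t → B * (b * t)) (^-distribˡ-+-* b s e))
  expand : ∀ b B C h u F Y → b * (B * C) * h * u * (F + b * (B * C) * h * u * Y) ≡
           b * B * C * u * (h * F) + b * (B * C) * h * u * (b * (B * C) * h * u) * Y
  expand = solve-∀
  collect : ∀ b B C h u r Y → b * B * C * u * (B * r) + b * (B * C) * h * u * (b * (B * C) * h * u) * Y ≡
            B * (b * (B * C)) * (u * (r + b * (C * h * h * u * Y)))
  collect = solve-∀

-- Stability along an arithmetic progression

module _ {A : Set} (f : ℕ → A) (λ′ : ℕ) where

  StableOn : ℕ → ℕ → Set
  StableOn m K = ∀ {k} → k < K → f (m + k * λ′ + λ′) ≡ f (m + k * λ′)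

  stableOn⇒constant : ∀ {m K} → StableOn m K → ∀ {k} → k ≤ K → f (m + k * λ′) ≡ f m
  stableOn⇒constant {m} st {zero}  _   = cong f (+-identityʳ m)
  stableOn⇒constant {m} st {suc k} k<K = begin
    f (m + (λ′ + k * λ′))  ≡⟨ cong f (trans (cong (m +_) (+-comm λ′ (k * λ′))) (sym (+-assoc m (k * λ′) λ′))) ⟩
    f (m + k * λ′ + λ′)    ≡⟨ st k<K ⟩
    f (m + k * λ′)         ≡⟨ stableOn⇒constant st (<⇒≤ k<K) ⟩
    f m                    ∎
    where open ≡-Reasoning

  moves-or-stableOn : DecidableEquality A → ∀ m K → (∃[ n ] (m ≤ n × f (n + λ′) ≢ f n)) ⊎ StableOn m K
  moves-or-stableOn _≟_ m K with anyUpTo? (λ k → ¬? (f (m + k * λ′ + λ′) ≟ f (m + k * λ′))) K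
  ... | yes (k , _ , moved) = inj₁ (m + k * λ′ , m≤m+n m (k * λ′) , moved)
  ... | no  never-moved     = inj₂ (λ k<K → decidable-stable (_ ≟ _) (λ moved → never-moved (_ , k<K , moved)))

-- The construction

module Construction (b : ℕ) .{{_ : NonZero b}} (2<b : 2 < b) (L N : ℕ) where

  1<b : 1 < b
  1<b = <-trans (n<1+n 1) 2<b

  λ′ : ℕ
  λ′ = suc L

  a : ℕ → ℕ
  a n = U b (n !) % b

  module G = CoprimeSplit (coprime-split b (L !) (1≤n! L))
  module Λ = CoprimeSplit (coprime-split b λ′ z<s)

  h : ℕ
  h = quotient G.d∣b^s

  hL!≡b^s*r : h * L ! ≡ b ^ G.s * G.r
  hL!≡b^s*r = begin
    h * L !          ≡⟨ cong (h *_) G.y≡d*r ⟩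
    h * (G.d * G.r)  ≡⟨ *-assoc h G.d G.r ⟨
    h * G.d * G.r    ≡⟨ cong (_* G.r) (m∣n⇒n≡quotient*m G.d∣b^s) ⟨
    b ^ G.s * G.r    ∎
    where open ≡-Reasoning

  -- E is chosen so that E > s (as factorial-block needs), d_λ ∣ b^E and T - 1 ≥ N + 4.
  e : ℕ
  e = Λ.s + (N + 4)

  E : ℕ
  E = suc (G.s + e)

  T : ℕ
  T = b ^ E * h

  E<T : E < T
  E<T = <-≤-trans (n<m^n 1<b E) (m≤m*n (b ^ E) h {{h≢0}})
    where
    h≢0 : NonZero h
    h≢0 = ≢-nonZero (λ h≡0 → ≢-nonZero⁻¹ (b ^ G.s) {{m^n≢0 b G.s}}
            (trans (m∣n⇒n≡quotient*m G.d∣b^s) (cong (_* G.d) h≡0)))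

  abstract
    m₀ : ℕ
    m₀ = pred T

    m₀+1≡T : suc m₀ ≡ T
    m₀+1≡T = suc-pred T {{>-nonZero (<-trans z<s E<T)}}

  N+4≤m₀ : N + 4 ≤ m₀
  N+4≤m₀ = begin
    N + 4      ≤⟨ m≤n+m (N + 4) Λ.s ⟩
    e          ≤⟨ m≤n+m e G.s ⟩
    G.s + e    <⟨ ≤-pred (subst (E <_) (sym m₀+1≡T) E<T) ⟩
    m₀         ∎
    where open ≤-Reasoning

  N≤m₀ : N ≤ m₀
  N≤m₀ = ≤-trans (m≤m+n N 4) N+4≤m₀

  4≤m₀ : 4 ≤ m₀
  4≤m₀ = ≤-trans (m≤n+m 4 N) N+4≤m₀

  d∣b^E : Λ.d ∣ b ^ E
  d∣b^E = ∣-trans Λ.d∣b^s (^-monoʳ-∣ b (≤-trans (m≤m+n Λ.s (N + 4)) (≤-trans (m≤n+m e G.s) (n≤1+n _))))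

  b^E/d : ℕ
  b^E/d = quotient d∣b^E

  b^E≡b^E/d*d : b ^ E ≡ b^E/d * Λ.d
  b^E≡b^E/d*d = m∣n⇒n≡quotient*m d∣b^E

  step : ℕ → ℕ
  step w = b^E/d * h * w

  point : ℕ → ℕ
  point w = m₀ + step w * λ′

  point+1≡ : ∀ w → suc (point w) ≡ T * (1 + Λ.r * w)
  point+1≡ w = begin
    suc m₀ + b^E/d * h * w * λ′                    ≡⟨ cong₂ _+_ m₀+1≡T (cong (b^E/d * h * w *_) Λ.y≡d*r) ⟩
    b ^ E * h + b^E/d * h * w * (Λ.d * Λ.r)        ≡⟨ cong (λ t → t * h + b^E/d * h * w * (Λ.d * Λ.r)) b^E≡b^E/d*d ⟩
    b^E/d * Λ.d * h + b^E/d * h * w * (Λ.d * Λ.r)  ≡⟨ factor b^E/d Λ.d h w Λ.r ⟩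
    b^E/d * Λ.d * h * (1 + Λ.r * w)                ≡⟨ cong (λ t → t * h * (1 + Λ.r * w)) b^E≡b^E/d*d ⟨
    T * (1 + Λ.r * w)                              ∎
    where
    open ≡-Reasoning
    factor : ∀ c d h w r → c * d * h + c * h * w * (d * r) ≡ c * d * h * (1 + r * w)
    factor = solve-∀

  U-after-block : ∀ m u → suc m ≡ T * u →
                  ∃[ Z ] (∀ {v} e′ → ¬ b ∣ v → U b (m !) * (u * (G.r + b * Z)) ≡ v * b ^ e′ → U b ((m + λ′) !) ≡ v)
  U-after-block m u m+1≡Tu with factorial-block {b} {h} {L} {G.s} {G.r} e u m hL!≡b^s*r m+1≡Tu
  ... | Z , [m+λ]!≡ = Z , λ {v} e′ b∤v A*Q≡v*b^e′ → trans (cong (U b) (trans [m+λ]!≡ (*-assoc (m !) _ _)))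
      (U-*-unique b 1<b (e′ + D) (1≤n! m) b∤v (begin
        U b (m !) * (b ^ D * Q)    ≡⟨ x∙yz≈xz∙y (U b (m !)) (b ^ D) Q ⟩
        U b (m !) * Q * b ^ D      ≡⟨ cong (_* b ^ D) A*Q≡v*b^e′ ⟩
        v * b ^ e′ * b ^ D         ≡⟨ *-assoc v (b ^ e′) (b ^ D) ⟩
        v * (b ^ e′ * b ^ D)       ≡⟨ cong (v *_) (^-distribˡ-+-* b e′ D) ⟨
        v * b ^ (e′ + D)           ∎))
    where
    open ≡-Reasoning
    D Q : ℕ
    D = G.s + suc (G.s + e)
    Q = u * (G.r + b * Z)

  a-after-coprime-block : ∀ m u → suc m ≡ T * u → Coprime b u → a (m + λ′) ≡ (U b (m !) * u * G.r) % b
  a-after-coprime-block m u m+1≡Tu b⊥u with U-after-block m u m+1≡Tu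
  ... | Z , U≡ = begin
    U b ((m + λ′) !) % b                ≡⟨ cong (_% b) (U≡ 0 b∤A*Q (sym (*-identityʳ (A * Q)))) ⟩
    (A * (u * (G.r + b * Z))) % b       ≡⟨ cong (_% b) (expand A u G.r b Z) ⟩
    (A * u * G.r + A * u * Z * b) % b   ≡⟨ [m+kn]%n≡m%n (A * u * G.r) (A * u * Z) b ⟩
    (A * u * G.r) % b                   ∎
    where
    open ≡-Reasoning
    A Q : ℕ
    A = U b (m !)
    Q = u * (G.r + b * Z)
    b∤A*Q : ¬ b ∣ A * Q
    b∤A*Q b∣A*Q = U-∤ b 1<b (1≤n! m) (coprime-divisor (coprime-* b⊥u (coprime-+-* Z (Coprimality.sym G.r⊥b)))
                    (subst (b ∣_) (*-comm A Q) b∣A*Q))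
    expand : ∀ A u r b Z → A * (u * (r + b * Z)) ≡ A * u * r + A * u * Z * b
    expand = solve-∀

  w₂ t₂ : ℕ
  w₂ = proj₁ (coprime⇒solvable Λ.r⊥b 2)
  t₂ = proj₁ (proj₂ (coprime⇒solvable Λ.r⊥b 2))

  r*w₂+2≡b*t₂ : Λ.r * w₂ + 2 ≡ b * t₂
  r*w₂+2≡b*t₂ = proj₂ (proj₂ (coprime⇒solvable Λ.r⊥b 2))

  K : ℕ
  K = suc (step w₂ + step Λ.r)

  -- u₂ = 1 + r_λ w₂ ≡ -1 (mod b), so adding the relations a(n + λ) ≡ a(n) u r at n = m₀ (u = 1)
  -- and at n = point w₂ (u = u₂) leaves 2 a(m₀) ≡ 0.
  stable⇒a+a≡b : StableOn a λ′ m₀ K → a m₀ + a m₀ ≡ b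
  stable⇒a+a≡b st = double≡0-mod⇒≡ (n≢0⇒n>0 A₀%b≢0) (m%n<n A₀ b) (begin
    (A₀ % b + A₀ % b) % b                   ≡⟨ %-distribˡ-+ A₀ A₀ b ⟨
    (A₀ + A₀) % b                           ≡⟨ %-cong-+ {b} (A₀ * 1 * G.r) A₀ (A₀ * u₂ * G.r) A₀ S₀ S₂ ⟨
    (A₀ * 1 * G.r + A₀ * u₂ * G.r) % b      ≡⟨ cong (_% b) (collect A₀ G.r Λ.r w₂) ⟩
    (A₀ * G.r * (Λ.r * w₂ + 2)) % b         ≡⟨ cong (λ t → (A₀ * G.r * t) % b) r*w₂+2≡b*t₂ ⟩
    (A₀ * G.r * (b * t₂)) % b               ≡⟨ cong (_% b) (x∙yz≈xz∙y (A₀ * G.r) b t₂) ⟩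
    (A₀ * G.r * t₂ * b) % b                 ≡⟨ m*n%n≡0 (A₀ * G.r * t₂) b ⟩
    0                                       ∎)
    where
    open ≡-Reasoning
    A₀ A₂ u₂ : ℕ
    A₀ = U b (m₀ !)
    A₂ = U b (point w₂ !)
    u₂ = 1 + Λ.r * w₂
    A₀%b≢0 : A₀ % b ≢ 0
    A₀%b≢0 = U-∤ b 1<b (1≤n! m₀) ∘ m%n≡0⇒n∣m A₀ b
    a[p₂]≡a[m₀] : a (point w₂) ≡ a m₀
    a[p₂]≡a[m₀] = stableOn⇒constant a λ′ {m₀} {K} st (<⇒≤ (s≤s (m≤m+n (step w₂) (step Λ.r))))
    S₀ : (A₀ * 1 * G.r) % b ≡ A₀ % b
    S₀ = trans (sym (a-after-coprime-block m₀ 1 (trans m₀+1≡T (sym (*-identityʳ T)))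
                                             (Coprimality.sym (Coprimality.1-coprimeTo b))))
               (subst (λ n → a (n + λ′) ≡ a n) (+-identityʳ m₀) (st z<s))
    S₂ : (A₀ * u₂ * G.r) % b ≡ A₀ % b
    S₂ = begin
      (A₀ * u₂ * G.r) % b   ≡⟨ %-cong-*ʳ {b} (A₂ * u₂) (A₀ * u₂) G.r (%-cong-*ʳ {b} A₂ A₀ u₂ a[p₂]≡a[m₀]) ⟨
      (A₂ * u₂ * G.r) % b   ≡⟨ a-after-coprime-block (point w₂) u₂ (point+1≡ w₂) b⊥u₂ ⟨
      a (point w₂ + λ′)     ≡⟨ st (s≤s (m≤m+n (step w₂) (step Λ.r))) ⟩
      a (point w₂)          ≡⟨ a[p₂]≡a[m₀] ⟩
      A₀ % b                ∎
      where
      b⊥u₂ : Coprime b u₂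
      b⊥u₂ = suc≡*⇒coprime (trans (+-comm 2 (Λ.r * w₂)) r*w₂+2≡b*t₂)
    collect : ∀ A r R w → A * 1 * r + A * (1 + R * w) * r ≡ A * r * (R * w + 2)
    collect = solve-∀

  a+a≡b⇒2∤a-after-block : ∀ m o → suc m ≡ T * (2 * o) → ¬ 2 ∣ o → a m + a m ≡ b → ¬ 2 ∣ a (m + λ′)
  a+a≡b⇒2∤a-after-block m o m+1≡T*2o 2∤o α+α≡b with U-after-block m (2 * o) m+1≡T*2o
  ... | Z , U≡ = 2∤O ∘ ∣n∣m%n⇒∣m {m = O} 2∣b ∘ subst (λ t → 2 ∣ t % b) (U≡ {O} 1 (2∤O ∘ ∣-trans 2∣b) A*2oQ≡O*b)
    where
    open ≡-Reasoning
    α A q Q O : ℕ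
    α = a m
    A = U b (m !)
    q = A / b
    Q = G.r + b * Z
    O = (1 + 2 * q) * o * Q
    2∣b : 2 ∣ b
    2∣b = double⇒even {α} α+α≡b
    2∤O : ¬ 2 ∣ O
    2∤O = ∤-* prime[2] (∤-* prime[2] (∤1+2* {q}) 2∤o) (∤-+-∣ (coprime-even⇒odd G.r⊥b 2∣b) (∣m⇒∣m*n Z 2∣b))
    A≡ : A ≡ α * (1 + 2 * q)
    A≡ = begin
      A                    ≡⟨ m≡m%n+[m/n]*n A b ⟩
      α + q * b            ≡⟨ cong (λ t → α + q * t) α+α≡b ⟨
      α + q * (α + α)      ≡⟨ regroup α q ⟩
      α * (1 + 2 * q)      ∎
      where
      regroup : ∀ α q → α + q * (α + α) ≡ α * (1 + 2 * q)
      regroup = solve-∀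
    A*2oQ≡O*b : A * (2 * o * Q) ≡ O * b ^ 1
    A*2oQ≡O*b = begin
      A * (2 * o * Q)                  ≡⟨ cong (λ s → s * (2 * o * Q)) A≡ ⟩
      α * (1 + 2 * q) * (2 * o * Q)    ≡⟨ regroup α q o Q ⟩
      O * ((α + α) * 1)                ≡⟨ cong (λ t → O * (t * 1)) α+α≡b ⟩
      O * (b * 1)                      ∎
      where
      regroup : ∀ α q o Q → α * (1 + 2 * q) * (2 * o * Q) ≡ (1 + 2 * q) * o * Q * ((α + α) * 1)
      regroup = solve-∀

  stable⇒2∤a : StableOn a λ′ m₀ K → ¬ 2 ∣ a m₀
  stable⇒2∤a st 2∣α = a+a≡b⇒2∤a-after-block (point Λ.r) o (trans (point+1≡ Λ.r) (cong (T *_) r²+1≡2o)) 2∤o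
      (trans (cong₂ _+_ a[p]≡α a[p]≡α) (stable⇒a+a≡b st))
      (subst (2 ∣_) (sym (trans (st (s≤s (m≤n+m (step Λ.r) (step w₂)))) a[p]≡α)) 2∣α)
    where
    a[p]≡α : a (point Λ.r) ≡ a m₀
    a[p]≡α = stableOn⇒constant a λ′ {m₀} {K} st (<⇒≤ (s≤s (m≤n+m (step Λ.r) (step w₂))))
    r²+1≡2*odd : ∃[ o ] (1 + Λ.r * Λ.r ≡ 2 * o × ¬ 2 ∣ o)
    r²+1≡2*odd = 1+odd²≡2*odd (coprime-even⇒odd Λ.r⊥b (double⇒even {a m₀} (stable⇒a+a≡b st)))
    o : ℕ
    o = proj₁ r²+1≡2*odd
    r²+1≡2o : 1 + Λ.r * Λ.r ≡ 2 * o
    r²+1≡2o = proj₁ (proj₂ r²+1≡2*odd)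
    2∤o : ¬ 2 ∣ o
    2∤o = proj₂ (proj₂ r²+1≡2*odd)

  stable⇒2∣a : StableOn a λ′ m₀ K → 2 ∣ a m₀
  stable⇒2∣a st = decidable-stable (2 ∣? α)
    (λ 2∤α → 2∤α (%-presˡ-∣ (U-factorial-even b 1<b b≡2α 2∤α 1<α 4≤m₀) (double⇒even {α} α+α≡b)))
    where
    α : ℕ
    α = a m₀
    α+α≡b : α + α ≡ b
    α+α≡b = stable⇒a+a≡b st
    b≡2α : b ≡ 2 * α
    b≡2α = trans (sym α+α≡b) (cong (α +_) (sym (+-identityʳ α)))
    1<α : 1 < α
    1<α = ≰⇒> (λ α≤1 → <⇒≱ 2<b (subst (_≤ 2) α+α≡b (+-mono-≤ α≤1 α≤1)))

  ¬stable : ¬ StableOn a λ′ m₀ K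
  ¬stable st = stable⇒2∤a st (stable⇒2∣a st)

corollary4p2 : (b : ℕ) → .{{_ : NonZero b}} → 2 < b → (λ′ N : ℕ) → 1 ≤ λ′ → 1 ≤ N →
    ∃[ n ] (N ≤ n × U b ((n + λ′) !) % b ≢ U b (n !) % b)
corollary4p2 b 2<b (suc L) N _ _ =
  [ (λ (n , m₀≤n , moved) → n , ≤-trans N≤m₀ m₀≤n , moved) , ⊥-elim ∘ ¬stable ]′
    (moves-or-stableOn a λ′ _≟_ m₀ K)
  where open Construction b 2<b L N
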